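{- For every integer $n \geq 1$, the number $Z(n)$ of (arbitrary) topologies $\mathcal{T}$ on $\{1,\ldots,n\}$ with covering dimension $\dim(\{1,\ldots,n\},\mathcal{T})=0$ satisfies \[ Z(n) = \sum_{\mathcal{P}\in \mathrm{Part}(n)} Z_{T_0}(|\mathcal{P}|), \] where $\mathrm{Part}(n)$ is the set of partitions of $\{1,\ldots,n\}$ and $Z_{T_0}(k)$ is the number of $T_0$-topologies $\mathcal{T}$ on $\{1,\ldots,k\}$ with $\dim(\{1,\ldots,k\},\mathcal{T})=0$.
   Context: A topology $\mathcal{T}$ on $X$ is $T_0$ if for any two distinct points $x,y$ there is an open set containing exactly one of them. A finite open covering of $(X,\mathcal{T})$ is a finite subset $\mathcal{A}\subseteq\mathcal{T}$ with $\bigcup\mathcal{A}=X$; $\mathcal{A}$ is finer than $\mathcal{B}$ if every $A\in\mathcal{A}$ is contained in some $B\in\mathcal{B}$. The order of a finite open covering $\mathcal{A}$ is the largest integer $m\geq -1$ such that $\mathcal{A}$ contains $m+1$ distinct sets with non-empty intersection. For $m\geq -1$, $\dim(X,\mathcal{T})\leq m$ means every finite open covering has a finer finite open covering of order $\leq m$; $\dim(X,\mathcal{T})=0$ means $\dim(X,\mathcal{T})\leq 0$ but not $\dim(X,\mathcal{T})\leq -1$ (the latter holds exactly for the empty space). -}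

module Defs where

open import Data.Nat using (ℕ; zero; suc; _+_; _^_)
open import Data.Bool using (Bool; true; false)
open import Data.Fin using (Fin; zero; suc; _↑ˡ_; _↑ʳ_)
open import Data.Fin.Subset using (Subset; _∈_; _∉_; _⊆_; ⊥; ⊤; _∩_; _∪_; ∣_∣)
open import Data.Vec using ([]; _∷_)
open import Data.Product using (Σ; ∃; _×_; _,_)
open import Data.Sum using (_⊎_)
open import Data.List using (List; length)
open import Data.List.Relation.Unary.Unique.Propositional using (Unique)
import Data.List.Membership.Propositional as LM
open import Relation.Nullary using (¬_)
open import Relation.Binary.PropositionalEquality using (_≡_; _≢_)
open import Function.Definitions using (Injective)

-- Points of the space {1,…,n} are Fin n; subsets are Subset n (= Vec Bool n).
-- A family of subsets of Fin n is a subset of Fin (2 ^ n), via the bijective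
-- binary encoding `code` of subsets.

code : ∀ {n} → Subset n → Fin (2 ^ n)
code {zero} [] = zero
code {suc n} (false ∷ s) = code s ↑ˡ (2 ^ n + 0)
code {suc n} (true ∷ s) = (2 ^ n) ↑ʳ (code s ↑ˡ 0)

record Family (n : ℕ) : Set where
  constructor fam
  field
    members : Subset (2 ^ n)
open Family public

infix 4 _∈F_
_∈F_ : ∀ {n} → Subset n → Family n → Set
S ∈F F = code S ∈ members F

-- Topology on a finite set: contains ∅ and X, closed under binary ∩ and ∪
-- (for a finite set this is equivalent to arbitrary unions / finite intersections).
record IsTopology {n : ℕ} (T : Family n) : Set where
  field
    empty∈ : ⊥ ∈F T
    full∈  : ⊤ ∈F T
    ∩-closed : ∀ U V → U ∈F T → V ∈F T → (U ∩ V) ∈F T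
    ∪-closed : ∀ U V → U ∈F T → V ∈F T → (U ∪ V) ∈F T

IsT0 : ∀ {n} → Family n → Set
IsT0 {n} T = ∀ (x y : Fin n) → x ≢ y →
  Σ (Subset n) λ U → U ∈F T × ((x ∈ U × y ∉ U) ⊎ (y ∈ U × x ∉ U))

IsOpenCover : ∀ {n} → Family n → Family n → Set
IsOpenCover {n} T A = (∀ (S : Subset n) → S ∈F A → S ∈F T) × (∀ (x : Fin n) → Σ (Subset n) λ S → S ∈F A × x ∈ S)

Finer : ∀ {n} → Family n → Family n → Set
Finer {n} A B = ∀ (S : Subset n) → S ∈F A → Σ (Subset n) λ S' → S' ∈F B × S ⊆ S'

-- OrderLE k A  means  "order of A ≤ k - 1" (k = m + 1, m ≥ -1):
-- A contains no k+1 = m+2 distinct sets with non-empty intersection.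
OrderLE : ∀ {n} → ℕ → Family n → Set
OrderLE {n} k A = ∀ (f : Fin (suc k) → Subset n) → Injective _≡_ _≡_ f →
  (∀ i → f i ∈F A) → ¬ (Σ (Fin n) λ x → ∀ i → x ∈ f i)

-- DimLE k T  means  "dim (Fin n, T) ≤ k - 1" (k = m + 1, m ≥ -1).
DimLE : ∀ {n} → ℕ → Family n → Set
DimLE {n} k T = ∀ (A : Family n) → IsOpenCover T A →
  Σ (Family n) λ B → IsOpenCover T B × Finer B A × OrderLE k B

-- dim = 0 :  dim ≤ 0  and not  dim ≤ -1.
Dim0 : ∀ {n} → Family n → Set
Dim0 T = DimLE 1 T × ¬ DimLE 0 T

ZeroDimTop : ∀ n → Family n → Set
ZeroDimTop n T = IsTopology T × Dim0 T

ZeroDimT0Top : ∀ n → Family n → Set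
ZeroDimT0Top n T = IsTopology T × IsT0 T × Dim0 T

-- A partition of Fin n: a family of non-empty blocks such that every point
-- lies in exactly one block.  Its size |P| is the number of blocks, ∣ P ∣.
IsPartition : ∀ {n} → Family n → Set
IsPartition {n} P =
  (∀ (S : Subset n) → S ∈F P → Σ (Fin n) λ x → x ∈ S) ×
  (∀ (x : Fin n) → Σ (Subset n) λ S → S ∈F P × x ∈ S) ×
  (∀ (x : Fin n) (S S' : Subset n) → S ∈F P → S' ∈F P → x ∈ S → x ∈ S' → S ≡ S')

Enumerates : ∀ {A : Set} → (A → Set) → List A → Set
Enumerates {A} P xs = Unique xs × (∀ (a : A) → (P a → a LM.∈ xs) × (a LM.∈ xs → P a))

HasCount : ∀ {A : Set} → (A → Set) → ℕ → Set
HasCount P k = Σ (List _) λ xs → Enumerates P xs × length xs ≡ k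

-- Any family T of subsets of Fin n partitions the points into classes of
-- T-indistinguishable points, and T is the pullback, along the quotient map onto
-- the classes, of a T0 family on the classes.  Conversely, pulling a T0 family T'
-- back along the quotient map of a partition P gives a family whose classes are the
-- blocks of P and whose quotient is T'.  Pullback along a surjection preserves and
-- reflects being a topology and every bound on covering dimension, so these mutually
-- inverse maps restrict to a bijection between zero-dimensional topologies on Fin n
-- and pairs (P , T') of a partition and a zero-dimensional T0 topology on its blocks.

module Submission where

open import Defs
open import Level using (0ℓ)
open import Data.Nat using (ℕ; zero; suc; _+_; _^_; _≤_)
open import Data.Nat.Properties using (≤-antisym)
open import Data.Bool using (true; false)
open import Data.Bool.Properties using (T-≡) renaming (_≟_ to _≟ᵇ_)
open import Data.Fin using (Fin; zero; suc; splitAt; _↑ˡ_; _↑ʳ_)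
open import Data.Fin.Properties using (splitAt-↑ˡ; splitAt-↑ʳ; splitAt⁻¹-↑ˡ; splitAt⁻¹-↑ʳ; suc-injective; injective⇒≤; any?) renaming (_≟_ to _≟ᶠ_)
open import Data.Fin.Subset using (Subset; _∈_; _∉_; _⊆_; ⊥; ⊤; _∩_; _∪_; ∣_∣; inside; outside)
open import Data.Fin.Subset.Properties using (_∈?_; ⊆-antisym; ⊆-reflexive; anySubset?; ∉⊥; ∈⊤; x∈p∩q⁺; x∈p∩q⁻; x∈p∪q⁺; x∈p∪q⁻)
open import Data.Vec using ([]; _∷_; lookup; tabulate; here; there)
open import Data.Vec.Properties using (≡-dec; []=⇒lookup; lookup⇒[]=; lookup∘tabulate)
open import Data.List as List using (List; []; _∷_; length; map; _++_)
open import Data.List.Properties using (length-++; length-map; map-cong)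
open import Data.Nat.ListAction using (sum)
open import Data.List.Relation.Unary.Unique.Propositional using (Unique)
open import Data.List.Relation.Unary.AllPairs using ([]; _∷_)
open import Data.List.Relation.Unary.Unique.Propositional.Properties using (++⁺; map⁺)
import Data.List.Relation.Unary.All as All
open import Data.List.Relation.Unary.Any as Any using (here; there)
open import Data.List.Relation.Unary.Any.Properties using (lookup-index)
import Data.List.Membership.Propositional as LM
open import Data.List.Membership.Propositional.Properties using (∈-lookup; ∈-map⁺; ∈-map⁻; ∈-++⁺ˡ; ∈-++⁺ʳ; ∈-++⁻)
open import Data.Product as Product using (Σ; ∃; _×_; _,_; proj₁; proj₂)
open import Data.Sum as Sum using (_⊎_; inj₁; inj₂)
open import Data.Empty using (⊥-elim)
open import Function using (_∘_)
open import Function.Bundles using (Equivalence)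
open import Relation.Unary using (Pred; Decidable)
open import Relation.Nullary using (Dec; yes; no; ¬_)
open import Relation.Nullary.Decidable using (isYes; toWitness; fromWitness; _×-dec_; ¬?; decidable-stable)
open import Relation.Binary.PropositionalEquality

_≟ˢ_ : ∀ {m} (U V : Subset m) → Dec (U ≡ V)
_≟ˢ_ = ≡-dec _≟ᵇ_

subsetOf : ∀ {m} {P : Pred (Fin m) 0ℓ} → Decidable P → Subset m
subsetOf P? = tabulate (λ i → isYes (P? i))

∈subsetOf⁺ : ∀ {m} {P : Pred (Fin m) 0ℓ} {P? : Decidable P} {i} → P i → i ∈ subsetOf P?
∈subsetOf⁺ {i = i} p =
  lookup⇒[]= i _ (trans (lookup∘tabulate _ i) (Equivalence.to T-≡ (fromWitness p)))

∈subsetOf⁻ : ∀ {m} {P : Pred (Fin m) 0ℓ} {P? : Decidable P} {i} → i ∈ subsetOf P? → P i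
∈subsetOf⁻ {i = i} i∈ =
  toWitness (Equivalence.from T-≡ (trans (sym (lookup∘tabulate _ i)) ([]=⇒lookup i∈)))

decode : ∀ {n} → Fin (2 ^ n) → Subset n
decode {zero} _ = []
decode {suc n} i with splitAt (2 ^ n) i
... | inj₁ j = outside ∷ decode j
... | inj₂ j with splitAt (2 ^ n) {0} j
...   | inj₁ j' = inside ∷ decode j'

decode-code : ∀ {n} (S : Subset n) → decode (code S) ≡ S
decode-code {zero} [] = refl
decode-code {suc n} (outside ∷ S)
  rewrite splitAt-↑ˡ (2 ^ n) (code S) (2 ^ n + 0) = cong (outside ∷_) (decode-code S)
decode-code {suc n} (inside ∷ S)
  rewrite splitAt-↑ʳ (2 ^ n) (2 ^ n + 0) (code S ↑ˡ 0) | splitAt-↑ˡ (2 ^ n) (code S) 0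
  = cong (inside ∷_) (decode-code S)

code-decode : ∀ {n} (i : Fin (2 ^ n)) → code {n} (decode i) ≡ i
code-decode {zero} zero = refl
code-decode {suc n} i with splitAt (2 ^ n) i in split₁
... | inj₁ j rewrite code-decode {n} j = splitAt⁻¹-↑ˡ split₁
... | inj₂ j with splitAt (2 ^ n) {0} j in split₂
...   | inj₁ j' rewrite code-decode {n} j' =
  trans (cong ((2 ^ n) ↑ʳ_) (splitAt⁻¹-↑ˡ split₂)) (splitAt⁻¹-↑ʳ split₁)

_∈F?_ : ∀ {n} (S : Subset n) (F : Family n) → Dec (S ∈F F)
S ∈F? F = code S ∈? members F

family-ext : ∀ {n} {A B : Family n} →
  (∀ S → S ∈F A → S ∈F B) → (∀ S → S ∈F B → S ∈F A) → A ≡ B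
family-ext {n} {fam a} {fam b} A⊆B B⊆A = cong fam (⊆-antisym (members⊆ A⊆B) (members⊆ B⊆A))
  where
  members⊆ : ∀ {c d} → (∀ S → S ∈F fam c → S ∈F fam d) → c ⊆ d
  members⊆ {c} {d} h {i} i∈c = subst (_∈ d) (code-decode {n} i)
    (h (decode i) (subst (_∈ c) (sym (code-decode {n} i)) i∈c))

familyOf : ∀ {n} {P : Pred (Subset n) 0ℓ} → Decidable P → Family n
familyOf P? = fam (subsetOf (λ i → P? (decode i)))

∈familyOf⁺ : ∀ {n} {P : Pred (Subset n) 0ℓ} {P? : Decidable P} {S} → P S → S ∈F familyOf P?
∈familyOf⁺ {P = P} {S = S} p = ∈subsetOf⁺ (subst P (sym (decode-code S)) p)

∈familyOf⁻ : ∀ {n} {P : Pred (Subset n) 0ℓ} {P? : Decidable P} {S} → S ∈F familyOf P? → P S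
∈familyOf⁻ {P = P} {S = S} S∈ = subst P (decode-code S) (∈subsetOf⁻ S∈)

unique-lookup : ∀ {A : Set} {xs : List A} → Unique xs →
  ∀ i j → List.lookup xs i ≡ List.lookup xs j → i ≡ j
unique-lookup (_ ∷ _) zero zero _ = refl
unique-lookup (x∉ ∷ _) zero (suc j) e = ⊥-elim (All.lookup x∉ (∈-lookup j) e)
unique-lookup (x∉ ∷ _) (suc i) zero e = ⊥-elim (All.lookup x∉ (∈-lookup i) (sym e))
unique-lookup (_ ∷ u) (suc i) (suc j) e = cong suc (unique-lookup u i j e)

count-mono : ∀ {A B : Set} {P : A → Set} {Q : B → Set} {xs : List A} {ys : List B} →
  Enumerates P xs → Enumerates Q ys → (f : A → B) → (∀ a → P a → Q (f a)) →
  (∀ a a' → P a → P a' → f a ≡ f a' → a ≡ a') → length xs ≤ length ys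
count-mono {P = P} {xs = xs} {ys} (uxs , enumP) (_ , enumQ) f f-sound f-inj = injective⇒≤ position-inj
  where
  P-at : ∀ i → P (List.lookup xs i)
  P-at i = proj₂ (enumP (List.lookup xs i)) (∈-lookup i)
  image∈ys : ∀ i → f (List.lookup xs i) LM.∈ ys
  image∈ys i = proj₁ (enumQ _) (f-sound _ (P-at i))
  position : Fin (length xs) → Fin (length ys)
  position i = Any.index (image∈ys i)
  position-inj : ∀ {i j} → position i ≡ position j → i ≡ j
  position-inj {i} {j} e = unique-lookup uxs i j (f-inj _ _ (P-at i) (P-at j)
    (trans (lookup-index (image∈ys i)) (trans (cong (List.lookup ys) e) (sym (lookup-index (image∈ys j))))))

count-bijection : ∀ {A B : Set} {P : A → Set} {Q : B → Set} {xs : List A} {ys : List B} →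
  Enumerates P xs → Enumerates Q ys → (f : A → B) (g : B → A) →
  (∀ a → P a → Q (f a)) → (∀ b → Q b → P (g b)) →
  (∀ a → P a → g (f a) ≡ a) → (∀ b → Q b → f (g b) ≡ b) → length xs ≡ length ys
count-bijection enumP enumQ f g f-sound g-sound g∘f f∘g = ≤-antisym
  (count-mono enumP enumQ f f-sound (λ a a' pa pa' e → trans (sym (g∘f a pa)) (trans (cong g e) (g∘f a' pa'))))
  (count-mono enumQ enumP g g-sound (λ b b' qb qb' e → trans (sym (f∘g b qb)) (trans (cong f e) (f∘g b' qb'))))

-- Images and preimages of families along a map ψ of subsets; they are families
-- because their membership conditions are decidable.
module _ {n k : ℕ} (ψ : Subset k → Subset n) where

  InImage : Family k → Subset n → Set
  InImage B U = Σ (Subset k) λ V → V ∈F B × ψ V ≡ U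

  inImage? : ∀ B → Decidable (InImage B)
  inImage? B U = anySubset? (λ V → V ∈F? B ×-dec ψ V ≟ˢ U)

  image : Family k → Family n
  image B = familyOf (inImage? B)

  preimage : Family n → Family k
  preimage A = familyOf (λ V → ψ V ∈F? A)

  ∈image⁺ : ∀ {B V} → V ∈F B → ψ V ∈F image B
  ∈image⁺ {B} {V} V∈B = ∈familyOf⁺ {P? = inImage? B} (V , V∈B , refl)

  ∈image⁻ : ∀ {B U} → U ∈F image B → InImage B U
  ∈image⁻ {B} = ∈familyOf⁻ {P? = inImage? B}

  ∈preimage⁺ : ∀ {A V} → ψ V ∈F A → V ∈F preimage A
  ∈preimage⁺ {A} = ∈familyOf⁺ {P? = λ V → ψ V ∈F? A}

  ∈preimage⁻ : ∀ {A V} → V ∈F preimage A → ψ V ∈F A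
  ∈preimage⁻ {A} = ∈familyOf⁻ {P? = λ V → ψ V ∈F? A}

lookup-transport : ∀ {m} {U : Subset m} {x y} → lookup U x ≡ lookup U y → x ∈ U → y ∈ U
lookup-transport {U = U} {x} {y} e x∈U = lookup⇒[]= y U (trans (sym e) ([]=⇒lookup x∈U))

lookup-cong : ∀ {m} {U : Subset m} {x y} → (x ∈ U → y ∈ U) → (y ∈ U → x ∈ U) → lookup U x ≡ lookup U y
lookup-cong {U = U} {x} {y} x→y y→x with lookup U x in ex | lookup U y in ey
... | true  | true  = refl
... | false | false = refl
... | true  | false = trans (sym ([]=⇒lookup (x→y (lookup⇒[]= x U ex)))) ey
... | false | true  = trans (sym ex) ([]=⇒lookup (y→x (lookup⇒[]= y U ey)))

lookup-≢ : ∀ {m} {U : Subset m} {x y} → lookup U x ≢ lookup U y → (x ∈ U × y ∉ U) ⊎ (y ∈ U × x ∉ U)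
lookup-≢ {U = U} {x} {y} x≢y with lookup U x in ex | lookup U y in ey
... | true  | true  = ⊥-elim (x≢y refl)
... | false | false = ⊥-elim (x≢y refl)
... | true  | false = inj₁ (lookup⇒[]= x U ex , λ y∈U → x≢y (trans (sym ([]=⇒lookup y∈U)) ey))
... | false | true  = inj₂ (lookup⇒[]= y U ey , λ x∈U → x≢y (trans (sym ex) ([]=⇒lookup x∈U)))

-- Pulling families back along a surjection
--
-- q : Fin n → Fin k is a surjection with section s, and ψ V is the preimage of V
-- under q; ψ is passed as a function together with its membership law, so that
-- for a partition it can be given by a formula that does not mention proofs.
module Pullback {n k : ℕ} (q : Fin n → Fin k) (s : Fin k → Fin n) (q∘s : ∀ b → q (s b) ≡ b)
  (ψ : Subset k → Subset n)
  (∈ψ⁺ : ∀ {V x} → q x ∈ V → x ∈ ψ V) (∈ψ⁻ : ∀ {V x} → x ∈ ψ V → q x ∈ V) where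

  s∈ψ⁺ : ∀ {V b} → b ∈ V → s b ∈ ψ V
  s∈ψ⁺ {V} {b} b∈V = ∈ψ⁺ (subst (_∈ V) (sym (q∘s b)) b∈V)

  s∈ψ⁻ : ∀ {V b} → s b ∈ ψ V → b ∈ V
  s∈ψ⁻ {V} {b} sb∈ψV = subst (_∈ V) (q∘s b) (∈ψ⁻ sb∈ψV)

  ψ-mono : ∀ {V W} → V ⊆ W → ψ V ⊆ ψ W
  ψ-mono V⊆W x∈ψV = ∈ψ⁺ (V⊆W (∈ψ⁻ x∈ψV))

  -- Because q is surjective, ψ reflects inclusion and is therefore injective.
  ψ-reflects-⊆ : ∀ {V W} → ψ V ⊆ ψ W → V ⊆ W
  ψ-reflects-⊆ ψV⊆ψW b∈V = s∈ψ⁻ (ψV⊆ψW (s∈ψ⁺ b∈V))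

  ψ-injective : ∀ {V W} → ψ V ≡ ψ W → V ≡ W
  ψ-injective e = ⊆-antisym (ψ-reflects-⊆ (⊆-reflexive e)) (ψ-reflects-⊆ (⊆-reflexive (sym e)))

  ψ-⊥ : ψ ⊥ ≡ ⊥
  ψ-⊥ = ⊆-antisym (λ x∈ → ⊥-elim (∉⊥ (∈ψ⁻ x∈))) (λ x∈ → ⊥-elim (∉⊥ x∈))

  ψ-⊤ : ψ ⊤ ≡ ⊤
  ψ-⊤ = ⊆-antisym (λ _ → ∈⊤) (λ _ → ∈ψ⁺ ∈⊤)

  ψ-∩ : ∀ V W → ψ (V ∩ W) ≡ ψ V ∩ ψ W
  ψ-∩ V W = ⊆-antisym
    (λ x∈ → x∈p∩q⁺ (Product.map ∈ψ⁺ ∈ψ⁺ (x∈p∩q⁻ V W (∈ψ⁻ x∈))))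
    (λ x∈ → ∈ψ⁺ (x∈p∩q⁺ (Product.map ∈ψ⁻ ∈ψ⁻ (x∈p∩q⁻ (ψ V) (ψ W) x∈))))

  ψ-∪ : ∀ V W → ψ (V ∪ W) ≡ ψ V ∪ ψ W
  ψ-∪ V W = ⊆-antisym
    (λ x∈ → x∈p∪q⁺ (Sum.map ∈ψ⁺ ∈ψ⁺ (x∈p∪q⁻ V W (∈ψ⁻ x∈))))
    (λ x∈ → ∈ψ⁺ (x∈p∪q⁺ (Sum.map ∈ψ⁻ ∈ψ⁻ (x∈p∪q⁻ (ψ V) (ψ W) x∈))))

  record IsPullback (T : Family n) (T' : Family k) : Set where
    field
      preserves : ∀ {V} → V ∈F T' → ψ V ∈F T
      reflects  : ∀ {V} → ψ V ∈F T → V ∈F T'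
      onto      : ∀ {U} → U ∈F T → Σ (Subset k) λ V → ψ V ≡ U
  open IsPullback

  pullback-unique : ∀ {T₁ T₂ T'} → IsPullback T₁ T' → IsPullback T₂ T' → T₁ ≡ T₂
  pullback-unique {T' = T'} pb₁ pb₂ = family-ext (transport pb₁ pb₂) (transport pb₂ pb₁)
    where
    transport : ∀ {A B} → IsPullback A T' → IsPullback B T' → ∀ U → U ∈F A → U ∈F B
    transport pa pb U U∈A with onto pa U∈A
    ... | V , refl = preserves pb (reflects pa U∈A)

  preimage-pullback : ∀ {T T'} → IsPullback T T' → preimage ψ T ≡ T'
  preimage-pullback pb =
    family-ext (λ V V∈ → reflects pb (∈preimage⁻ ψ V∈)) (λ V V∈ → ∈preimage⁺ ψ (preserves pb V∈))

  image-finer : ∀ {B' A} → Finer B' (preimage ψ A) → Finer (image ψ B') A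
  image-finer B'≤A' U U∈ with ∈image⁻ ψ U∈
  ... | V , V∈B' , refl with B'≤A' V V∈B'
  ...   | W , W∈A' , V⊆W = ψ W , ∈preimage⁻ ψ W∈A' , ψ-mono V⊆W

  preimage-finer : ∀ {B A'} → Finer B (image ψ A') → Finer (preimage ψ B) A'
  preimage-finer B≤A V V∈ with B≤A (ψ V) (∈preimage⁻ ψ V∈)
  ... | U , U∈A , ψV⊆U with ∈image⁻ ψ U∈A
  ...   | W , W∈A' , refl = W , W∈A' , ψ-reflects-⊆ ψV⊆U

  image-order : ∀ {m B'} → OrderLE m B' → OrderLE m (image ψ B')
  image-order {m} {B'} order f f-inj f∈B (x , x∈f) =
    order g g-inj g∈B' (q x , λ i → ∈ψ⁻ (subst (x ∈_) (sym (ψg≡f i)) (x∈f i)))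
    where
    g : Fin (suc m) → Subset k
    g i = proj₁ (∈image⁻ ψ (f∈B i))
    g∈B' : ∀ i → g i ∈F B'
    g∈B' i = proj₁ (proj₂ (∈image⁻ ψ (f∈B i)))
    ψg≡f : ∀ i → ψ (g i) ≡ f i
    ψg≡f i = proj₂ (proj₂ (∈image⁻ ψ (f∈B i)))
    g-inj : ∀ {i j} → g i ≡ g j → i ≡ j
    g-inj {i} {j} e = f-inj (trans (sym (ψg≡f i)) (trans (cong ψ e) (ψg≡f j)))

  preimage-order : ∀ {m B} → OrderLE m B → OrderLE m (preimage ψ B)
  preimage-order order f f-inj f∈B' (b , b∈f) =
    order (ψ ∘ f) (f-inj ∘ ψ-injective) (λ i → ∈preimage⁻ ψ (f∈B' i)) (s b , λ i → s∈ψ⁺ (b∈f i))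

  module _ {T : Family n} {T' : Family k} (pb : IsPullback T T') where

    image-cover : ∀ {A'} → IsOpenCover T' A' → IsOpenCover T (image ψ A')
    image-cover {A'} (A'⊆T' , A'-covers) = A⊆T , A-covers
      where
      A⊆T : ∀ U → U ∈F image ψ A' → U ∈F T
      A⊆T U U∈ with ∈image⁻ ψ U∈
      ... | V , V∈A' , refl = preserves pb (A'⊆T' V V∈A')
      A-covers : ∀ x → Σ (Subset n) λ U → U ∈F image ψ A' × x ∈ U
      A-covers x with A'-covers (q x)
      ... | V , V∈A' , qx∈V = ψ V , ∈image⁺ ψ V∈A' , ∈ψ⁺ qx∈V

    preimage-cover : ∀ {A} → IsOpenCover T A → IsOpenCover T' (preimage ψ A)
    preimage-cover {A} (A⊆T , A-covers) = A'⊆T' , A'-covers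
      where
      A'⊆T' : ∀ V → V ∈F preimage ψ A → V ∈F T'
      A'⊆T' V V∈ = reflects pb (A⊆T (ψ V) (∈preimage⁻ ψ V∈))
      A'-covers : ∀ b → Σ (Subset k) λ V → V ∈F preimage ψ A × b ∈ V
      A'-covers b with A-covers (s b)
      ... | U , U∈A , sb∈U with onto pb (A⊆T U U∈A)
      ...   | V , refl = V , ∈preimage⁺ ψ U∈A , s∈ψ⁻ sb∈U

    dim-pull : ∀ {m} → DimLE m T' → DimLE m T
    dim-pull dim' A A-cover with dim' (preimage ψ A) (preimage-cover A-cover)
    ... | B' , B'-cover , B'≤A' , B'-order =
      image ψ B' , image-cover B'-cover , image-finer B'≤A' , image-order B'-order

    dim-push : ∀ {m} → DimLE m T → DimLE m T'
    dim-push dim A' A'-cover with dim (image ψ A') (image-cover A'-cover)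
    ... | B , B-cover , B≤A , B-order =
      preimage ψ B , preimage-cover B-cover , preimage-finer B≤A , preimage-order B-order

    dim0-pull : Dim0 T' → Dim0 T
    dim0-pull (dim≤0 , ¬dim≤-1) = dim-pull dim≤0 , λ dim≤-1 → ¬dim≤-1 (dim-push dim≤-1)

    dim0-push : Dim0 T → Dim0 T'
    dim0-push (dim≤0 , ¬dim≤-1) = dim-push dim≤0 , λ dim≤-1 → ¬dim≤-1 (dim-pull dim≤-1)

    separate-push : ∀ {U b b'} → U ∈F T → lookup U (s b) ≢ lookup U (s b') →
      Σ (Subset k) λ V → V ∈F T' × ((b ∈ V × b' ∉ V) ⊎ (b' ∈ V × b ∉ V))
    separate-push U∈T differ with onto pb U∈T
    ... | V , refl = V , reflects pb U∈T , Sum.map reps-in-V reps-in-V (lookup-≢ differ)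
      where
      reps-in-V : ∀ {c c'} → s c ∈ ψ V × s c' ∉ ψ V → c ∈ V × c' ∉ V
      reps-in-V (sc∈ψV , sc'∉ψV) = s∈ψ⁻ sc∈ψV , sc'∉ψV ∘ s∈ψ⁺

    closed-pull : (_⊙_ : ∀ {m} → Subset m → Subset m → Subset m) → (∀ V W → ψ (V ⊙ W) ≡ ψ V ⊙ ψ W) →
      (∀ V W → V ∈F T' → W ∈F T' → (V ⊙ W) ∈F T') → ∀ U U' → U ∈F T → U' ∈F T → (U ⊙ U') ∈F T
    closed-pull _⊙_ ψ-⊙ closed' U U' U∈ U'∈ with onto pb U∈ | onto pb U'∈
    ... | V , refl | V' , refl =
      subst (_∈F T) (ψ-⊙ V V') (preserves pb (closed' V V' (reflects pb U∈) (reflects pb U'∈)))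

    closed-push : (_⊙_ : ∀ {m} → Subset m → Subset m → Subset m) → (∀ V W → ψ (V ⊙ W) ≡ ψ V ⊙ ψ W) →
      (∀ U U' → U ∈F T → U' ∈F T → (U ⊙ U') ∈F T) → ∀ V W → V ∈F T' → W ∈F T' → (V ⊙ W) ∈F T'
    closed-push _⊙_ ψ-⊙ closed V W V∈ W∈ =
      reflects pb (subst (_∈F T) (sym (ψ-⊙ V W)) (closed (ψ V) (ψ W) (preserves pb V∈) (preserves pb W∈)))

    topology-pull : IsTopology T' → IsTopology T
    topology-pull top' = record
      { empty∈   = subst (_∈F T) ψ-⊥ (preserves pb (empty∈ top'))
      ; full∈    = subst (_∈F T) ψ-⊤ (preserves pb (full∈ top'))
      ; ∩-closed = closed-pull _∩_ ψ-∩ (∩-closed top')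
      ; ∪-closed = closed-pull _∪_ ψ-∪ (∪-closed top')
      }
      where open IsTopology

    topology-push : IsTopology T → IsTopology T'
    topology-push top = record
      { empty∈   = reflects pb (subst (_∈F T) (sym ψ-⊥) (empty∈ top))
      ; full∈    = reflects pb (subst (_∈F T) (sym ψ-⊤) (full∈ top))
      ; ∩-closed = closed-push _∩_ ψ-∩ (∩-closed top)
      ; ∪-closed = closed-push _∪_ ψ-∪ (∪-closed top)
      }
      where open IsTopology

select : ∀ {m} (v : Subset m) → Fin ∣ v ∣ → Fin m
select (inside ∷ v) zero = zero
select (inside ∷ v) (suc b) = suc (select v b)
select (outside ∷ v) b = suc (select v b)

select∈ : ∀ {m} (v : Subset m) b → select v b ∈ v
select∈ (inside ∷ v) zero = here
select∈ (inside ∷ v) (suc b) = there (select∈ v b)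
select∈ (outside ∷ v) b = there (select∈ v b)

rank : ∀ {m} {v : Subset m} {i} → i ∈ v → Fin ∣ v ∣
rank {v = inside ∷ v} here = zero
rank {v = inside ∷ v} (there i∈v) = suc (rank i∈v)
rank {v = outside ∷ v} (there i∈v) = rank i∈v

select-rank : ∀ {m} {v : Subset m} {i} (i∈v : i ∈ v) → select v (rank i∈v) ≡ i
select-rank {v = inside ∷ v} here = refl
select-rank {v = inside ∷ v} (there i∈v) = cong suc (select-rank i∈v)
select-rank {v = outside ∷ v} (there i∈v) = cong suc (select-rank i∈v)

select-injective : ∀ {m} (v : Subset m) {b c} → select v b ≡ select v c → b ≡ c
select-injective (inside ∷ v) {zero} {zero} _ = refl
select-injective (inside ∷ v) {suc b} {suc c} e = cong suc (select-injective v (suc-injective e))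
select-injective (outside ∷ v) e = select-injective v (suc-injective e)

block : ∀ {n} (P : Family n) → Fin ∣ members P ∣ → Subset n
block P b = decode (select (members P) b)

block∈ : ∀ {n} (P : Family n) b → block P b ∈F P
block∈ {n} P b = subst (_∈ members P) (sym (code-decode {n} _)) (select∈ (members P) b)

block-injective : ∀ {n} (P : Family n) {b c} → block P b ≡ block P c → b ≡ c
block-injective {n} P {b} {c} e = select-injective (members P)
  (trans (sym (code-decode {n} _)) (trans (cong code e) (code-decode {n} _)))

block-rank : ∀ {n} (P : Family n) {S} (S∈P : S ∈F P) → block P (rank S∈P) ≡ S
block-rank P {S} S∈P = trans (cong decode (select-rank S∈P)) (decode-code S)

-- The union of the blocks indexed by V; for a partition, the preimage of V under
-- the quotient map.
blockUnion : ∀ {n} (P : Family n) → Subset ∣ members P ∣ → Subset n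
blockUnion P V = subsetOf (λ x → any? (λ b → b ∈? V ×-dec x ∈? block P b))

module Quotient {n : ℕ} (P : Family n) (isP : IsPartition P) where

  private
    nonempty : ∀ S → S ∈F P → Σ (Fin n) λ x → x ∈ S
    nonempty = proj₁ isP
    covers : ∀ x → Σ (Subset n) λ S → S ∈F P × x ∈ S
    covers = proj₁ (proj₂ isP)
    disjoint : ∀ x S S' → S ∈F P → S' ∈F P → x ∈ S → x ∈ S' → S ≡ S'
    disjoint = proj₂ (proj₂ isP)

  classOf : Fin n → Fin ∣ members P ∣
  classOf x = rank (proj₁ (proj₂ (covers x)))

  ∈block-classOf : ∀ x → x ∈ block P (classOf x)
  ∈block-classOf x = subst (x ∈_) (sym (block-rank P (proj₁ (proj₂ (covers x))))) (proj₂ (proj₂ (covers x)))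

  classOf-unique : ∀ {x b} → x ∈ block P b → classOf x ≡ b
  classOf-unique {x} {b} x∈b = block-injective P
    (disjoint x _ _ (block∈ P (classOf x)) (block∈ P b) (∈block-classOf x) x∈b)

  rep : Fin ∣ members P ∣ → Fin n
  rep b = proj₁ (nonempty (block P b) (block∈ P b))

  rep∈block : ∀ b → rep b ∈ block P b
  rep∈block b = proj₂ (nonempty (block P b) (block∈ P b))

  classOf-rep : ∀ b → classOf (rep b) ≡ b
  classOf-rep b = classOf-unique (rep∈block b)

  ∈blockUnion⁺ : ∀ {V x} → classOf x ∈ V → x ∈ blockUnion P V
  ∈blockUnion⁺ {x = x} cx∈V = ∈subsetOf⁺ (classOf x , cx∈V , ∈block-classOf x)

  ∈blockUnion⁻ : ∀ {V x} → x ∈ blockUnion P V → classOf x ∈ V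
  ∈blockUnion⁻ {V} x∈ with ∈subsetOf⁻ x∈
  ... | b , b∈V , x∈b = subst (_∈ V) (sym (classOf-unique x∈b)) b∈V

  open Pullback classOf rep classOf-rep (blockUnion P) ∈blockUnion⁺ ∈blockUnion⁻ public

Indist : ∀ {n} → Family n → Fin n → Fin n → Set
Indist T x y = ∀ U → U ∈F T → lookup U x ≡ lookup U y

indist-sym : ∀ {n} {T : Family n} {x y} → Indist T x y → Indist T y x
indist-sym xy U U∈T = sym (xy U U∈T)

indist-trans : ∀ {n} {T : Family n} {x y z} → Indist T x y → Indist T y z → Indist T x z
indist-trans xy yz U U∈T = trans (xy U U∈T) (yz U U∈T)

Separator : ∀ {n} → Family n → Fin n → Fin n → Subset n → Set
Separator T x y U = U ∈F T × lookup U x ≢ lookup U y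

separator? : ∀ {n} (T : Family n) x y → Decidable (Separator T x y)
separator? T x y U = U ∈F? T ×-dec ¬? (lookup U x ≟ᵇ lookup U y)

no-separator⇒indist : ∀ {n} {T : Family n} {x y} → ¬ ∃ (Separator T x y) → Indist T x y
no-separator⇒indist {x = x} {y} ¬sep U U∈T =
  decidable-stable (lookup U x ≟ᵇ lookup U y) (λ x≢y → ¬sep (U , U∈T , x≢y))

indist? : ∀ {n} (T : Family n) x y → Dec (Indist T x y)
indist? T x y with anySubset? (separator? T x y)
... | yes (U , U∈T , x≢y) = no (λ xy → x≢y (xy U U∈T))
... | no ¬sep = yes (no-separator⇒indist ¬sep)

separate : ∀ {n} (T : Family n) {x y} → ¬ Indist T x y → ∃ (Separator T x y)
separate T {x} {y} ¬xy with anySubset? (separator? T x y)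
... | yes sep = sep
... | no ¬sep = ⊥-elim (¬xy (no-separator⇒indist ¬sep))

indistClass : ∀ {n} → Family n → Fin n → Subset n
indistClass T x = subsetOf (indist? T x)

indistClass-≡ : ∀ {n} (T : Family n) {x y} → Indist T x y → indistClass T x ≡ indistClass T y
indistClass-≡ T xy = ⊆-antisym
  (λ z∈ → ∈subsetOf⁺ (indist-trans (indist-sym xy) (∈subsetOf⁻ z∈)))
  (λ z∈ → ∈subsetOf⁺ (indist-trans xy (∈subsetOf⁻ z∈)))

IsIndistClass : ∀ {n} → Family n → Subset n → Set
IsIndistClass T S = ∃ λ x → indistClass T x ≡ S

kolmogorovPartition : ∀ {n} → Family n → Family n
kolmogorovPartition T = familyOf (λ S → any? (λ x → indistClass T x ≟ˢ S))

∈kolmogorovPartition⁺ : ∀ {n} (T : Family n) x → indistClass T x ∈F kolmogorovPartition T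
∈kolmogorovPartition⁺ T x = ∈familyOf⁺ {P? = λ S → any? (λ x → indistClass T x ≟ˢ S)} (x , refl)

∈kolmogorovPartition⁻ : ∀ {n} (T : Family n) {S} → S ∈F kolmogorovPartition T → IsIndistClass T S
∈kolmogorovPartition⁻ T = ∈familyOf⁻ {P? = λ S → any? (λ x → indistClass T x ≟ˢ S)}

kolmogorov-isPartition : ∀ {n} (T : Family n) → IsPartition (kolmogorovPartition T)
kolmogorov-isPartition {n} T = nonempty , covers , disjoint
  where
  nonempty : ∀ S → S ∈F kolmogorovPartition T → Σ (Fin n) λ x → x ∈ S
  nonempty S S∈ with ∈kolmogorovPartition⁻ T S∈
  ... | x , refl = x , ∈subsetOf⁺ (λ U _ → refl)
  covers : ∀ x → Σ (Subset n) λ S → S ∈F kolmogorovPartition T × x ∈ S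
  covers x = indistClass T x , ∈kolmogorovPartition⁺ T x , ∈subsetOf⁺ (λ U _ → refl)
  disjoint : ∀ x S S' → S ∈F kolmogorovPartition T → S' ∈F kolmogorovPartition T →
    x ∈ S → x ∈ S' → S ≡ S'
  disjoint x S S' S∈ S'∈ x∈S x∈S' with ∈kolmogorovPartition⁻ T S∈ | ∈kolmogorovPartition⁻ T S'∈
  ... | y , refl | z , refl = indistClass-≡ T (indist-trans (∈subsetOf⁻ x∈S) (indist-sym (∈subsetOf⁻ x∈S')))

quotientFamily : ∀ {n} (P : Family n) → Family n → Family ∣ members P ∣
quotientFamily P T = preimage (blockUnion P) T

QuotientData : ℕ → Set
QuotientData n = Σ (Family n) λ P → Family ∣ members P ∣

quotientData : ∀ {n} (P : Family n) → Family ∣ members P ∣ → QuotientData n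
quotientData P T' = P , T'

IsZeroDimT0Quotient : ∀ {n} → QuotientData n → Set
IsZeroDimT0Quotient d = IsPartition (proj₁ d) × ZeroDimT0Top ∣ members (proj₁ d) ∣ (proj₂ d)

kolmogorov : ∀ {n} → Family n → QuotientData n
kolmogorov T = kolmogorovPartition T , quotientFamily (kolmogorovPartition T) T

inflate : ∀ {n} → QuotientData n → Family n
inflate (P , T') = image (blockUnion P) T'

module Kolmogorov {n : ℕ} (T : Family n) where

  private
    KP : Family n
    KP = kolmogorovPartition T

  open Quotient KP (kolmogorov-isPartition T)

  indist⇔same-class : ∀ {x y} → (Indist T x y → classOf x ≡ classOf y) × (classOf x ≡ classOf y → Indist T x y)
  indist⇔same-class {x} {y} with ∈kolmogorovPartition⁻ T (block∈ KP (classOf x))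
  ... | w , class≡block = to , from
    where
    w~x : Indist T w x
    w~x = ∈subsetOf⁻ (subst (x ∈_) (sym class≡block) (∈block-classOf x))
    to : Indist T x y → classOf x ≡ classOf y
    to xy = sym (classOf-unique (subst (y ∈_) class≡block (∈subsetOf⁺ (indist-trans w~x xy))))
    from : classOf x ≡ classOf y → Indist T x y
    from e = indist-trans (indist-sym w~x)
      (∈subsetOf⁻ (subst (y ∈_) (sym class≡block) (subst (λ b → y ∈ block KP b) (sym e) (∈block-classOf y))))

  -- Open sets are unions of classes, so T is the pullback of its quotient family.
  kolmogorov-pullback : IsPullback T (quotientFamily KP T)
  kolmogorov-pullback = record
    { preserves = ∈preimage⁻ (blockUnion KP) ; reflects = ∈preimage⁺ (blockUnion KP) ; onto = onto }
    where
    onto : ∀ {U} → U ∈F T → Σ (Subset ∣ members KP ∣) λ V → blockUnion KP V ≡ U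
    onto {U} U∈T = subsetOf (λ b → rep b ∈? U) , ⊆-antisym to from
      where
      x~rep : ∀ x → lookup U x ≡ lookup U (rep (classOf x))
      x~rep x = proj₂ indist⇔same-class (sym (classOf-rep (classOf x))) U U∈T
      to : blockUnion KP (subsetOf (λ b → rep b ∈? U)) ⊆ U
      to x∈ = lookup-transport (sym (x~rep _)) (∈subsetOf⁻ (∈blockUnion⁻ x∈))
      from : U ⊆ blockUnion KP (subsetOf (λ b → rep b ∈? U))
      from x∈U = ∈blockUnion⁺ (∈subsetOf⁺ (lookup-transport (x~rep _) x∈U))

  quotient-T0 : IsT0 (quotientFamily KP T)
  quotient-T0 b b' b≢b' = separate-push kolmogorov-pullback U∈T differ
    where
    distinguishable : ¬ Indist T (rep b) (rep b')
    distinguishable ind = b≢b' (trans (sym (classOf-rep b)) (trans (proj₁ indist⇔same-class ind) (classOf-rep b')))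
    U : Subset n
    U = proj₁ (separate T distinguishable)
    U∈T : U ∈F T
    U∈T = proj₁ (proj₂ (separate T distinguishable))
    differ : lookup U (rep b) ≢ lookup U (rep b')
    differ = proj₂ (proj₂ (separate T distinguishable))

module Inflation {n : ℕ} (P : Family n) (isP : IsPartition P) (T' : Family ∣ members P ∣) where

  open Quotient P isP

  inflated : Family n
  inflated = inflate (P , T')

  inflated-pullback : IsPullback inflated T'
  inflated-pullback = record { preserves = ∈image⁺ (blockUnion P) ; reflects = reflects ; onto = onto }
    where
    reflects : ∀ {V} → blockUnion P V ∈F inflated → V ∈F T'
    reflects ψV∈ with ∈image⁻ (blockUnion P) ψV∈
    ... | W , W∈T' , ψW≡ψV = subst (_∈F T') (ψ-injective ψW≡ψV) W∈T'
    onto : ∀ {U} → U ∈F inflated → Σ (Subset ∣ members P ∣) λ V → blockUnion P V ≡ U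
    onto U∈ with ∈image⁻ (blockUnion P) U∈
    ... | V , _ , ψV≡U = V , ψV≡U

  module _ (t0 : IsT0 T') where

    indist⇒same-class : ∀ {x y} → Indist inflated x y → classOf x ≡ classOf y
    indist⇒same-class {x} {y} xy with classOf x ≟ᶠ classOf y
    ... | yes e = e
    ... | no cx≢cy = ⊥-elim (unseparated (t0 (classOf x) (classOf y) cx≢cy))
      where
      same : ∀ {V} → V ∈F T' → lookup (blockUnion P V) x ≡ lookup (blockUnion P V) y
      same V∈T' = xy _ (∈image⁺ (blockUnion P) V∈T')
      unseparated : ¬ Σ (Subset ∣ members P ∣) λ V →
        V ∈F T' × ((classOf x ∈ V × classOf y ∉ V) ⊎ (classOf y ∈ V × classOf x ∉ V))
      unseparated (V , V∈T' , inj₁ (cx∈V , cy∉V)) =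
        cy∉V (∈blockUnion⁻ (lookup-transport (same V∈T') (∈blockUnion⁺ cx∈V)))
      unseparated (V , V∈T' , inj₂ (cy∈V , cx∉V)) =
        cx∉V (∈blockUnion⁻ (lookup-transport (sym (same V∈T')) (∈blockUnion⁺ cy∈V)))

    same-class⇒indist : ∀ {x y} → classOf x ≡ classOf y → Indist inflated x y
    same-class⇒indist {x} {y} e U U∈ with IsPullback.onto inflated-pullback U∈
    ... | V , refl = lookup-cong (λ x∈ → ∈blockUnion⁺ (subst (_∈ V) e (∈blockUnion⁻ x∈)))
                                 (λ y∈ → ∈blockUnion⁺ (subst (_∈ V) (sym e) (∈blockUnion⁻ y∈)))

    indistClass-inflated : ∀ x → indistClass inflated x ≡ block P (classOf x)
    indistClass-inflated x = ⊆-antisym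
      (λ {y} y∈ → subst (λ b → y ∈ block P b) (sym (indist⇒same-class (∈subsetOf⁻ y∈))) (∈block-classOf y))
      (λ y∈ → ∈subsetOf⁺ (same-class⇒indist (sym (classOf-unique y∈))))

    kolmogorovPartition-inflated : kolmogorovPartition inflated ≡ P
    kolmogorovPartition-inflated = family-ext to from
      where
      to : ∀ S → S ∈F kolmogorovPartition inflated → S ∈F P
      to S S∈ with ∈kolmogorovPartition⁻ inflated S∈
      ... | x , refl = subst (_∈F P) (sym (indistClass-inflated x)) (block∈ P (classOf x))
      from : ∀ S → S ∈F P → S ∈F kolmogorovPartition inflated
      from S S∈P = subst (_∈F kolmogorovPartition inflated) class≡S (∈kolmogorovPartition⁺ inflated (rep b))
        where
        b : Fin ∣ members P ∣
        b = rank S∈P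
        class≡S : indistClass inflated (rep b) ≡ S
        class≡S = trans (indistClass-inflated (rep b)) (trans (cong (block P) (classOf-rep b)) (block-rank P S∈P))

kolmogorov-sound : ∀ {n} (T : Family n) → ZeroDimTop n T → IsZeroDimT0Quotient (kolmogorov T)
kolmogorov-sound T (top , dim0) =
  kolmogorov-isPartition T , topology-push kolmogorov-pullback top , quotient-T0 , dim0-push kolmogorov-pullback dim0
  where
  open Kolmogorov T
  open Quotient (kolmogorovPartition T) (kolmogorov-isPartition T)

inflate-sound : ∀ {n} (d : QuotientData n) → IsZeroDimT0Quotient d → ZeroDimTop n (inflate d)
inflate-sound (P , T') (isP , top' , _ , dim0') = topology-pull inflated-pullback top' , dim0-pull inflated-pullback dim0'
  where
  open Inflation P isP T'
  open Quotient P isP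

inflate-kolmogorov : ∀ {n} (T : Family n) → inflate (kolmogorov T) ≡ T
inflate-kolmogorov T = pullback-unique (Inflation.inflated-pullback P isP _) (Kolmogorov.kolmogorov-pullback T)
  where
  P : Family _
  P = kolmogorovPartition T
  isP : IsPartition P
  isP = kolmogorov-isPartition T
  open Quotient P isP

kolmogorov-inflate : ∀ {n} (d : QuotientData n) → IsZeroDimT0Quotient d → kolmogorov (inflate d) ≡ d
kolmogorov-inflate (P , T') (isP , _ , t0 , _) = same-partition (kolmogorovPartition-inflated t0)
  where
  open Inflation P isP T'
  open Quotient P isP
  same-partition : ∀ {P₁} → P₁ ≡ P → (P₁ , quotientFamily P₁ inflated) ≡ (P , T')
  same-partition refl = cong (P ,_) (preimage-pullback inflated-pullback)

module _ (fams : (k : ℕ) → List (Family k)) where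

  pairsOver : ∀ {n} → List (Family n) → List (QuotientData n)
  pairsOver [] = []
  pairsOver (P ∷ Ps) = map (quotientData P) (fams ∣ members P ∣) ++ pairsOver Ps

  length-pairsOver : ∀ {n} (Ps : List (Family n)) →
    length (pairsOver Ps) ≡ sum (map (λ P → length (fams ∣ members P ∣)) Ps)
  length-pairsOver [] = refl
  length-pairsOver (P ∷ Ps) =
    trans (length-++ (map (quotientData P) (fams ∣ members P ∣)) {pairsOver Ps})
          (cong₂ _+_ (length-map (quotientData P) (fams ∣ members P ∣)) (length-pairsOver Ps))

  ∈pairsOver⁺ : ∀ {n} {Ps : List (Family n)} {P T'} →
    P LM.∈ Ps → T' LM.∈ fams ∣ members P ∣ → (P , T') LM.∈ pairsOver Ps
  ∈pairsOver⁺ {Ps = P ∷ _} (here refl) T'∈ = ∈-++⁺ˡ (∈-map⁺ (quotientData P) T'∈)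
  ∈pairsOver⁺ {Ps = P ∷ _} (there P∈) T'∈ =
    ∈-++⁺ʳ (map (quotientData P) (fams ∣ members P ∣)) (∈pairsOver⁺ P∈ T'∈)

  ∈pairsOver⁻ : ∀ {n} (Ps : List (Family n)) {d} → d LM.∈ pairsOver Ps →
    proj₁ d LM.∈ Ps × proj₂ d LM.∈ fams ∣ members (proj₁ d) ∣
  ∈pairsOver⁻ (P ∷ Ps) d∈ with ∈-++⁻ (map (quotientData P) (fams ∣ members P ∣)) d∈
  ... | inj₁ d∈head with ∈-map⁻ (quotientData P) d∈head
  ...   | T' , T'∈ , refl = here refl , T'∈
  ∈pairsOver⁻ (P ∷ Ps) d∈ | inj₂ d∈tail = Product.map₁ there (∈pairsOver⁻ Ps d∈tail)

  unique-pairsOver : ∀ {n} {Ps : List (Family n)} → Unique Ps → (∀ k → Unique (fams k)) → Unique (pairsOver Ps)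
  unique-pairsOver {Ps = []} _ _ = []
  unique-pairsOver {Ps = P ∷ Ps} (P∉Ps ∷ uPs) uFams =
    ++⁺ (map⁺ pair-injective (uFams ∣ members P ∣)) (unique-pairsOver uPs uFams) disjoint
    where
    pair-injective : ∀ {T₁ T₂} → (P , T₁) ≡ (P , T₂) → T₁ ≡ T₂
    pair-injective refl = refl
    disjoint : ∀ {d} → ¬ (d LM.∈ map (quotientData P) (fams ∣ members P ∣) × d LM.∈ pairsOver Ps)
    disjoint (d∈head , d∈tail) with ∈-map⁻ (quotientData P) d∈head
    ... | _ , _ , refl = All.lookup P∉Ps (proj₁ (∈pairsOver⁻ Ps d∈tail)) refl

  pairsOver-enumerates : ∀ {n} {R : Family n → Set} {Q : (k : ℕ) → Family k → Set} {Ps : List (Family n)} →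
    Enumerates R Ps → (∀ k → Enumerates (Q k) (fams k)) →
    Enumerates (λ d → R (proj₁ d) × Q ∣ members (proj₁ d) ∣ (proj₂ d)) (pairsOver Ps)
  pairsOver-enumerates {R = R} {Q} {Ps} (uPs , enumPs) enumFams =
    unique-pairsOver uPs (λ k → proj₁ (enumFams k)) , λ d → complete d , sound d
    where
    complete : ∀ d → R (proj₁ d) × Q ∣ members (proj₁ d) ∣ (proj₂ d) → d LM.∈ pairsOver Ps
    complete (P , T') (rP , qT') = ∈pairsOver⁺ (proj₁ (enumPs P) rP) (proj₁ (proj₂ (enumFams _) T') qT')
    sound : ∀ d → d LM.∈ pairsOver Ps → R (proj₁ d) × Q ∣ members (proj₁ d) ∣ (proj₂ d)
    sound (P , T') d∈ with ∈pairsOver⁻ Ps d∈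
    ... | P∈ , T'∈ = proj₂ (enumPs P) P∈ , proj₂ (proj₂ (enumFams _) T') T'∈

theorem3 : ∀ (n : ℕ) → 1 ≤ n →
    ∀ (Z : ℕ) → HasCount (ZeroDimTop n) Z →
    ∀ (ZT0 : ℕ → ℕ) → (∀ k → HasCount (ZeroDimT0Top k) (ZT0 k)) →
    ∀ (parts : List (Family n)) → Enumerates IsPartition parts →
    Z ≡ sum (map (λ P → ZT0 ∣ members P ∣) parts)
theorem3 n _ Z (tops , enumTops , #tops) ZT0 countT0 parts enumParts = begin
  Z                                                     ≡⟨ sym #tops ⟩
  length tops                                           ≡⟨ kolmogorov-bijection ⟩
  length (pairsOver t0Tops parts)                       ≡⟨ length-pairsOver t0Tops parts ⟩
  sum (map (λ P → length (t0Tops ∣ members P ∣)) parts) ≡⟨ cong sum (map-cong #t0Tops parts) ⟩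
  sum (map (λ P → ZT0 ∣ members P ∣) parts)             ∎
  where
  open ≡-Reasoning
  t0Tops : (k : ℕ) → List (Family k)
  t0Tops k = proj₁ (countT0 k)
  #t0Tops : ∀ P → length (t0Tops ∣ members P ∣) ≡ ZT0 ∣ members P ∣
  #t0Tops P = proj₂ (proj₂ (countT0 ∣ members P ∣))
  enumQuotients : Enumerates IsZeroDimT0Quotient (pairsOver t0Tops parts)
  enumQuotients = pairsOver-enumerates t0Tops enumParts (λ k → proj₁ (proj₂ (countT0 k)))
  kolmogorov-bijection : length tops ≡ length (pairsOver t0Tops parts)
  kolmogorov-bijection = count-bijection enumTops enumQuotients kolmogorov inflate
    kolmogorov-sound inflate-sound (λ T _ → inflate-kolmogorov T) kolmogorov-inflate
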